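{- Let $\mathbb{F}$ be a field, $\mathbf{x}=(x_1,\ldots,x_n)$, and let $\mathbf{f}(\mathbf{x}),\mathbf{g}(\mathbf{x})\in\mathbb{F}[\mathbf{x}]^m$ be vectors whose entries are homogeneous polynomials of degree $d_f$ (for all entries of $\mathbf{f}$) and $d_g$ (for all entries of $\mathbf{g}$), respectively. Then $$\mathrm{rank}(\mathcal{C}(\mathbf{f}(\mathbf{x})\otimes\mathbf{g}(\mathbf{x})))\le\min\left\{\binom{n+d_f-1}{n-1},\binom{n+d_g-1}{n-1}\right\}.$$
   Context: $\mathbf{f}\otimes\mathbf{g}$ is the $m\times m$ polynomial matrix with $(i,j)$ entry $f_ig_j$. For a matrix of polynomials $M(\mathbf{x})=\sum_{\mathbf{e}\in\mathbb{N}^n}M_{\mathbf{e}}\mathbf{x}^{\mathbf{e}}$ with $M_{\mathbf{e}}\in\mathbb{F}^{m\times m}$ (expansion in the monomial basis), the coefficient space is $\mathcal{C}(M(\mathbf{x}))=\mathrm{span}\{M_{\mathbf{e}}:\mathbf{e}\in\mathbb{N}^n\}$. For a set $\mathcal{M}$ of matrices, $\mathrm{rank}(\mathcal{M})=\max_{M\in\mathcal{M}}\mathrm{rank}(M)$. -}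

module Defs where

open import Level using (Level; _⊔_) renaming (suc to lsuc)
open import Algebra.Bundles using (CommutativeRing)
open import Data.Nat as ℕ using (ℕ; zero; suc)
open import Data.Fin using (Fin)
open import Data.Vec using (Vec; []; _∷_)
open import Data.List using (List; []; _∷_; map; concatMap; upTo)
open import Data.Product using (Σ; _×_; _,_; ∃)
open import Relation.Nullary using (¬_)
open import Relation.Binary.PropositionalEquality using (_≡_)

record Field (c ℓ : Level) : Set (lsuc (c ⊔ ℓ)) where
  field
    commutativeRing : CommutativeRing c ℓ
  open CommutativeRing commutativeRing public
  field
    0≉1     : ¬ (0# ≈ 1#)
    inverse : ∀ x → ¬ (x ≈ 0#) → Σ Carrier λ y → x * y ≈ 1#

Exponent : ℕ → Set
Exponent n = Vec ℕ n

degree : ∀ {n} → Exponent n → ℕ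
degree []       = 0
degree (k ∷ ks) = k ℕ.+ degree ks

-- All exponent vectors a with a ≤ e componentwise (paired with e - a),
-- i.e. all decompositions e = a + b.
splits : ∀ {n} → Exponent n → List (Exponent n × Exponent n)
splits []       = (([] , []) ∷ [])
splits (k ∷ ks) =
  concatMap (λ i → map (λ { (a , b) → ((i ∷ a) , ((k ℕ.∸ i) ∷ b)) }) (splits ks))
            (upTo (suc k))

module _ {c ℓ} (𝔽 : Field c ℓ) where
  open Field 𝔽

  sumL : List Carrier → Carrier
  sumL []       = 0#
  sumL (x ∷ xs) = x + sumL xs

  sumFin : ∀ {r} → (Fin r → Carrier) → Carrier
  sumFin {zero}  v = 0#
  sumFin {suc r} v = v Fin.zero + sumFin (λ i → v (Fin.suc i))
    where import Data.Fin as Fin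

  -- A polynomial in n variables, given by its coefficient in the monomial
  -- basis: coefficient p e of x^e.  (Finiteness of support is implied by
  -- homogeneity, which is always assumed below.)
  Poly : ℕ → Set c
  Poly n = Exponent n → Carrier

  IsHomogeneous : ∀ {n} → ℕ → Poly n → Set ℓ
  IsHomogeneous d p = ∀ e → ¬ (degree e ≡ d) → p e ≈ 0#

  _·P_ : ∀ {n} → Poly n → Poly n → Poly n
  (p ·P q) e = sumL (map (λ { (a , b) → p a * q b }) (splits e))

  Matrix : ℕ → Set c
  Matrix m = Fin m → Fin m → Carrier

  LinIndepCols : ∀ {m r} → Matrix m → (Fin r → Fin m) → Set (c ⊔ ℓ)
  LinIndepCols {m} {r} M col =
    (λ′ : Fin r → Carrier) →
    (∀ i → sumFin (λ k → λ′ k * M i (col k)) ≈ 0#) →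
    ∀ k → λ′ k ≈ 0#

  RankAtMost : ∀ {m} → Matrix m → ℕ → Set (c ⊔ ℓ)
  RankAtMost {m} M k = ∀ r (col : Fin r → Fin m) → LinIndepCols M col → r ℕ.≤ k

  _⊗_ : ∀ {n m} → (Fin m → Poly n) → (Fin m → Poly n) → Fin m → Fin m → Poly n
  (f ⊗ g) i j = f i ·P g j

  coeffMatrix : ∀ {n m} → (Fin m → Fin m → Poly n) → Exponent n → Matrix m
  coeffMatrix P e i j = P i j e

  -- Elements of the coefficient space 𝒞(P) = span{M_e}: finite linear
  -- combinations Σ_k c_k M_{e_k}, given by a list of (c_k , e_k).
  spanElem : ∀ {n m} → (Fin m → Fin m → Poly n) → List (Carrier × Exponent n) → Matrix m
  spanElem P cs i j = sumL (map (λ { (a , e) → a * coeffMatrix P e i j }) cs)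

  -- rank(𝒞(P)) ≤ k : every matrix in the coefficient space has rank ≤ k.
  CoeffSpaceRankAtMost : ∀ {n m} → (Fin m → Fin m → Poly n) → ℕ → Set (c ⊔ ℓ)
  CoeffSpaceRankAtMost P k = ∀ cs → RankAtMost (spanElem P cs) k

module Submission where

-- Every entry of f is homogeneous of degree d_f, hence a linear combination
-- f_i = Σ_t f_i(a_t) x^(a_t) of the N = C(n + d_f - 1, n - 1) monomials x^(a_t) of
-- degree d_f.  An element Σ_e c_e M_e of the coefficient space has (i, j) entry
-- B(f_i, g_j), where B(φ, ψ) = Σ_e c_e [x^e](φ ψ) is bilinear; so it factors as
-- P Q with P_it = f_i(a_t) and Q_tj = B(x^(a_t), g_j), an m × N times N × m
-- product, and has rank at most N.  Symmetrically for g.  The rank bound is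
-- Gaussian elimination: N rows and more than N columns leave a nonzero kernel
-- vector.  As equality in the field need not be decidable, that vector is only
-- obtained under a double negation, which suffices since the rank bound is a
-- decidable inequality between naturals.

open import Defs
open import Level using (_⊔_)
open import Data.Bool using (true; false; T; if_then_else_)
open import Data.Nat using (ℕ; zero; suc; _≤_; _<_; _≤?_; z≤n; s≤s)
import Data.Nat as ℕ
import Data.Nat.Properties as ℕ
open import Data.Nat.Combinatorics using (_C_; nCn≡1; nCk+nC[k+1]≡[n+1]C[k+1])
open import Data.Fin using (Fin; zero; suc; punchIn; punchOut)
import Data.Fin.Properties as Fin
open import Data.Vec using ([]; _∷_)
import Data.Vec.Properties as Vec
open import Data.List using (List; []; _∷_; map; _++_; length; lookup)
open import Data.List.Properties using (length-map; length-++)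
open import Data.Product using (Σ-syntax; ∃-syntax; _×_; _,_)
open import Data.Sum using (_⊎_; inj₁; inj₂)
open import Function using (_∘_; Injective)
open import Relation.Nullary using (¬_; Dec; yes; no; does; contradiction)
open import Relation.Nullary.Decidable using (decidable-stable; ¬¬-excluded-middle)
open import Relation.Binary.PropositionalEquality
  using (_≡_; _≢_; refl; cong; cong₂; subst; module ≡-Reasoning)
import Relation.Binary.PropositionalEquality as ≡

-- A separate module keeps ℕ's _+_ out of scope of the field section below.
module Monomials where
  open Data.Nat using (_+_; _∸_)

  _≟ₑ_ : ∀ {n} (a b : Exponent n) → Dec (a ≡ b)
  _≟ₑ_ = Vec.≡-dec ℕ._≟_

  multiplicity : ∀ {n} → Exponent n → List (Exponent n) → ℕ
  multiplicity a []       = 0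
  multiplicity a (x ∷ xs) = if does (x ≟ₑ a) then suc (multiplicity a xs) else multiplicity a xs

  multiplicity-++ : ∀ {n} (a : Exponent n) xs ys →
                    multiplicity a (xs ++ ys) ≡ multiplicity a xs + multiplicity a ys
  multiplicity-++ a []       ys = refl
  multiplicity-++ a (x ∷ xs) ys with x ≟ₑ a
  ... | yes _ = cong suc (multiplicity-++ a xs ys)
  ... | no  _ = multiplicity-++ a xs ys

  multiplicity-map-injective : ∀ {m n} {g : Exponent m → Exponent n} → Injective _≡_ _≡_ g →
                               ∀ a xs → multiplicity (g a) (map g xs) ≡ multiplicity a xs
  multiplicity-map-injective g-inj a []       = refl
  multiplicity-map-injective {g = g} g-inj a (x ∷ xs) with g x ≟ₑ g a | x ≟ₑ a
  ... | yes _     | yes _   = cong suc (multiplicity-map-injective g-inj a xs)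
  ... | yes gx≡ga | no x≢a  = contradiction (g-inj gx≡ga) x≢a
  ... | no gx≢ga  | yes x≡a = contradiction (cong g x≡a) gx≢ga
  ... | no _      | no _    = multiplicity-map-injective g-inj a xs

  multiplicity-map-∉ : ∀ {m n} (g : Exponent m → Exponent n) a → (∀ x → g x ≢ a) →
                       ∀ xs → multiplicity a (map g xs) ≡ 0
  multiplicity-map-∉ g a a∉g []       = refl
  multiplicity-map-∉ g a a∉g (x ∷ xs) with g x ≟ₑ a
  ... | yes gx≡a = contradiction gx≡a (a∉g x)
  ... | no  _    = multiplicity-map-∉ g a a∉g xs

  incrementHead : ∀ {n} → Exponent (suc n) → Exponent (suc n)
  incrementHead (k ∷ ks) = suc k ∷ ks

  incrementHead-injective : ∀ {n} → Injective _≡_ _≡_ (incrementHead {n})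
  incrementHead-injective {x = _ ∷ _} {y = _ ∷ _} refl = refl

  -- Pascal's rule: a monomial of degree d + 1 in x₁, …, xₙ₊₁ either avoids x₁
  -- or is x₁ times a monomial of degree d.
  monomials : (n d : ℕ) → List (Exponent n)
  monomials zero    zero    = [] ∷ []
  monomials zero    (suc d) = []
  monomials (suc n) zero    = map (0 ∷_) (monomials n 0)
  monomials (suc n) (suc d) =
    map (0 ∷_) (monomials n (suc d)) ++ map incrementHead (monomials (suc n) d)

  multiplicity-monomials : ∀ n d (a : Exponent n) →
                           multiplicity a (monomials n d) ≡ (if degree a ℕ.≡ᵇ d then 1 else 0)
  multiplicity-monomials zero    zero    []          = refl
  multiplicity-monomials zero    (suc d) []          = refl
  multiplicity-monomials (suc n) zero    (zero  ∷ a) =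
    ≡.trans (multiplicity-map-injective Vec.∷-injectiveʳ a (monomials n 0))
            (multiplicity-monomials n 0 a)
  multiplicity-monomials (suc n) zero    (suc k ∷ a) =
    multiplicity-map-∉ (0 ∷_) (suc k ∷ a) (λ _ ()) (monomials n 0)
  multiplicity-monomials (suc n) (suc d) (zero  ∷ a) = begin
    multiplicity (0 ∷ a) (map (0 ∷_) (monomials n (suc d)) ++ map incrementHead (monomials (suc n) d))
      ≡⟨ multiplicity-++ (0 ∷ a) (map (0 ∷_) (monomials n (suc d))) _ ⟩
    multiplicity (0 ∷ a) (map (0 ∷_) (monomials n (suc d)))
      + multiplicity (0 ∷ a) (map incrementHead (monomials (suc n) d))
      ≡⟨ cong₂ _+_ (multiplicity-map-injective Vec.∷-injectiveʳ a (monomials n (suc d)))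
                   (multiplicity-map-∉ incrementHead (0 ∷ a) (λ { (_ ∷ _) () }) (monomials (suc n) d)) ⟩
    multiplicity a (monomials n (suc d)) + 0
      ≡⟨ ℕ.+-identityʳ _ ⟩
    multiplicity a (monomials n (suc d))
      ≡⟨ multiplicity-monomials n (suc d) a ⟩
    (if degree a ℕ.≡ᵇ suc d then 1 else 0) ∎
    where open ≡-Reasoning
  multiplicity-monomials (suc n) (suc d) (suc k ∷ a) = begin
    multiplicity (suc k ∷ a) (map (0 ∷_) (monomials n (suc d)) ++ map incrementHead (monomials (suc n) d))
      ≡⟨ multiplicity-++ (suc k ∷ a) (map (0 ∷_) (monomials n (suc d))) _ ⟩
    multiplicity (suc k ∷ a) (map (0 ∷_) (monomials n (suc d)))
      + multiplicity (suc k ∷ a) (map incrementHead (monomials (suc n) d))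
      ≡⟨ cong₂ _+_ (multiplicity-map-∉ (0 ∷_) (suc k ∷ a) (λ _ ()) (monomials n (suc d)))
                   (multiplicity-map-injective incrementHead-injective (k ∷ a) (monomials (suc n) d)) ⟩
    multiplicity (k ∷ a) (monomials (suc n) d)
      ≡⟨ multiplicity-monomials (suc n) d (k ∷ a) ⟩
    (if k + degree a ℕ.≡ᵇ d then 1 else 0) ∎
    where open ≡-Reasoning

  length-monomials-0 : ∀ n → length (monomials n 0) ≡ 1
  length-monomials-0 zero    = refl
  length-monomials-0 (suc n) = ≡.trans (length-map (0 ∷_) (monomials n 0)) (length-monomials-0 n)

  length-monomials : ∀ n d → length (monomials (suc n) d) ≡ (n + d) C n
  length-monomials n       zero    = begin
    length (monomials (suc n) 0) ≡⟨ length-monomials-0 (suc n) ⟩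
    1                            ≡⟨ nCn≡1 n ⟨
    n C n                        ≡⟨ cong (_C n) (ℕ.+-identityʳ n) ⟨
    (n + 0) C n                  ∎
    where open ≡-Reasoning
  length-monomials zero    (suc d) =
    ≡.trans (length-map incrementHead (monomials 1 d)) (length-monomials 0 d)
  length-monomials (suc n) (suc d) = begin
    length (map (0 ∷_) (monomials (suc n) (suc d)) ++ map incrementHead (monomials (suc (suc n)) d))
      ≡⟨ length-++ (map (0 ∷_) (monomials (suc n) (suc d))) ⟩
    length (map (0 ∷_) (monomials (suc n) (suc d))) + length (map incrementHead (monomials (suc (suc n)) d))
      ≡⟨ cong₂ _+_ (≡.trans (length-map (0 ∷_) (monomials (suc n) (suc d))) (length-monomials n (suc d)))
                   (≡.trans (length-map incrementHead (monomials (suc (suc n)) d)) (length-monomials (suc n) d)) ⟩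
    (n + suc d) C n + (suc n + d) C suc n
      ≡⟨ cong (λ k → (n + suc d) C n + k C suc n) (ℕ.+-suc n d) ⟨
    (n + suc d) C n + (n + suc d) C suc n
      ≡⟨ nCk+nC[k+1]≡[n+1]C[k+1] (n + suc d) n ⟩
    suc (n + suc d) C suc n ∎
    where open ≡-Reasoning

  length-monomials-≤ : ∀ n d → length (monomials n d) ≤ (n + d ∸ 1) C (n ∸ 1)
  length-monomials-≤ zero    zero    = ℕ.≤-refl
  length-monomials-≤ zero    (suc d) = z≤n
  length-monomials-≤ (suc n) d       = ℕ.≤-reflexive (length-monomials n d)

open Monomials

¬¬-all-or-counterexample : ∀ {p} {N} (P : Fin N → Set p) → ¬ ¬ ((∀ t → P t) ⊎ ∃[ t ] ¬ P t)
¬¬-all-or-counterexample {N = zero}  P k = k (inj₁ λ ())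
¬¬-all-or-counterexample {N = suc N} P k =
  ¬¬-excluded-middle λ P₀? → ¬¬-all-or-counterexample (P ∘ suc) λ rest → k (combine P₀? rest)
  where
  combine : Dec (P zero) → (∀ t → P (suc t)) ⊎ ∃[ t ] ¬ P (suc t) →
            (∀ t → P t) ⊎ ∃[ t ] ¬ P t
  combine (no ¬P₀) _                = inj₂ (zero , ¬P₀)
  combine (yes P₀) (inj₁ Pₛ)        = inj₁ (Fin.∀-cons P₀ Pₛ)
  combine (yes _)  (inj₂ (t , ¬Pₜ)) = inj₂ (suc t , ¬Pₜ)

module _ {c ℓ} (𝔽 : Field c ℓ) where
  open Field 𝔽 hiding (zero) renaming (refl to ≈-refl; sym to ≈-sym; trans to ≈-trans)
  open import Algebra.Properties.Semiring.Sum semiring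
    using (sum; sum-syntax; sum-cong-≋; sum-replicate-zero; ∑-comm; ∑-distrib-+; *-distribˡ-sum; *-distribʳ-sum)
  open import Algebra.Definitions.RawMonoid +-rawMonoid using () renaming (_×_ to _·ℕ_)
  open import Algebra.Properties.Ring ring using (-‿distribˡ-*; -‿distribʳ-*; -1*x≈-x)
  open import Algebra.Properties.CommutativeSemigroup *-commutativeSemigroup using (x∙yz≈y∙xz; x∙yz≈y∙zx)
  open import Relation.Binary.Reasoning.Setoid setoid

  sumFin≡sum : ∀ {r} (v : Fin r → Carrier) → sumFin 𝔽 v ≡ sum v
  sumFin≡sum {zero}  v = refl
  sumFin≡sum {suc r} v = cong (v zero +_) (sumFin≡sum (v ∘ suc))

  sumL-map≡sum-lookup : ∀ {a} {X : Set a} (h : X → Carrier) xs →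
                        sumL 𝔽 (map h xs) ≡ sum (h ∘ lookup xs)
  sumL-map≡sum-lookup h []       = refl
  sumL-map≡sum-lookup h (x ∷ xs) = cong (h x +_) (sumL-map≡sum-lookup h xs)

  sumL-map-expand : ∀ {a} {X : Set a} {N} {h : X → Carrier} {w : Fin N → Carrier}
                    {R : Fin N → X → Carrier} → (∀ y → h y ≈ ∑[ t < N ] (w t * R t y)) →
                    ∀ xs → sumL 𝔽 (map h xs) ≈ ∑[ t < N ] (w t * sumL 𝔽 (map (R t) xs))
  sumL-map-expand {N = N} {h} {w} {R} h≈ xs = begin
    sumL 𝔽 (map h xs)
      ≡⟨ sumL-map≡sum-lookup h xs ⟩
    ∑[ s < length xs ] h (lookup xs s)
      ≈⟨ sum-cong-≋ (h≈ ∘ lookup xs) ⟩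
    ∑[ s < length xs ] ∑[ t < N ] (w t * R t (lookup xs s))
      ≈⟨ ∑-comm (λ s t → w t * R t (lookup xs s)) ⟩
    ∑[ t < N ] ∑[ s < length xs ] (w t * R t (lookup xs s))
      ≈⟨ sum-cong-≋ (λ t → *-distribˡ-sum (w t) (R t ∘ lookup xs)) ⟨
    ∑[ t < N ] (w t * ∑[ s < length xs ] R t (lookup xs s))
      ≈⟨ sum-cong-≋ (λ t → *-congˡ (reflexive (sumL-map≡sum-lookup (R t) xs))) ⟨
    ∑[ t < N ] (w t * sumL 𝔽 (map (R t) xs)) ∎

  δ : ∀ {n} → Exponent n → Exponent n → Carrier
  δ x a = if does (x ≟ₑ a) then 1# else 0#

  sumL-*δ : ∀ {n} (φ : Poly 𝔽 n) a xs →
           sumL 𝔽 (map (λ x → φ x * δ x a) xs) ≈ multiplicity a xs ·ℕ φ a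
  sumL-*δ φ a []       = ≈-refl
  sumL-*δ φ a (x ∷ xs) with x ≟ₑ a
  ... | yes refl = +-cong (*-identityʳ (φ x)) (sumL-*δ φ a xs)
  ... | no  _    = ≈-trans (+-cong (zeroʳ (φ x)) (sumL-*δ φ a xs)) (+-identityˡ _)

  homogeneous-expansion : ∀ {n d} {φ : Poly 𝔽 n} → IsHomogeneous 𝔽 d φ → ∀ a →
                          φ a ≈ ∑[ t < length (monomials n d) ]
                                  (φ (lookup (monomials n d) t) * δ (lookup (monomials n d) t) a)
  homogeneous-expansion {n} {d} {φ} φ-hom a = begin
    φ a
      ≈⟨ multiplicity·φa≈φa ⟨
    multiplicity a (monomials n d) ·ℕ φ a
      ≈⟨ sumL-*δ φ a (monomials n d) ⟨
    sumL 𝔽 (map (λ x → φ x * δ x a) (monomials n d))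
      ≡⟨ sumL-map≡sum-lookup (λ x → φ x * δ x a) (monomials n d) ⟩
    ∑[ t < length (monomials n d) ] (φ (lookup (monomials n d) t) * δ (lookup (monomials n d) t) a) ∎
    where
    multiplicity·φa≈φa : multiplicity a (monomials n d) ·ℕ φ a ≈ φ a
    multiplicity·φa≈φa rewrite multiplicity-monomials n d a with degree a ℕ.≡ᵇ d in deg≡ᵇd
    ... | true  = +-identityʳ (φ a)
    ... | false = ≈-sym (φ-hom a λ deg≡d → subst T deg≡ᵇd (ℕ.≡⇒≡ᵇ (degree a) d deg≡d))

  -- The (i, j) entry of spanElem (f ⊗ g) cs unfolds to coeffPairing cs (f i) (g j).
  coeffPairing : ∀ {n} → List (Carrier × Exponent n) → Poly 𝔽 n → Poly 𝔽 n → Carrier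
  coeffPairing cs φ ψ = sumL 𝔽 (map (λ (a , e) → a * _·P_ 𝔽 φ ψ e) cs)

  ·P-expand : ∀ {n N} {φ ψ : Poly 𝔽 n} {w : Fin N → Carrier} {φs ψs : Fin N → Poly 𝔽 n} →
              (∀ p q → φ p * ψ q ≈ ∑[ t < N ] (w t * (φs t p * ψs t q))) →
              ∀ e → _·P_ 𝔽 φ ψ e ≈ ∑[ t < N ] (w t * _·P_ 𝔽 (φs t) (ψs t) e)
  ·P-expand {w = w} {φs} {ψs} φψ≈ e =
    sumL-map-expand {w = w} {R = λ t (p , q) → φs t p * ψs t q} (λ (p , q) → φψ≈ p q) (splits e)

  coeffPairing-expand : ∀ {n N} {φ ψ : Poly 𝔽 n} {w : Fin N → Carrier} {φs ψs : Fin N → Poly 𝔽 n} →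
                        (∀ p q → φ p * ψ q ≈ ∑[ t < N ] (w t * (φs t p * ψs t q))) →
                        ∀ cs → coeffPairing cs φ ψ ≈ ∑[ t < N ] (w t * coeffPairing cs (φs t) (ψs t))
  coeffPairing-expand {N = N} {φ} {ψ} {w} {φs} {ψs} φψ≈ =
    sumL-map-expand {w = w} {R = λ t (a , e) → a * _·P_ 𝔽 (φs t) (ψs t) e} term-expand
    where
    term-expand : ∀ ((a , e) : Carrier × Exponent _) →
                  a * _·P_ 𝔽 φ ψ e ≈ ∑[ t < N ] (w t * (a * _·P_ 𝔽 (φs t) (ψs t) e))
    term-expand (a , e) = begin
      a * _·P_ 𝔽 φ ψ e
        ≈⟨ *-congˡ (·P-expand {w = w} {φs} {ψs} φψ≈ e) ⟩
      a * ∑[ t < N ] (w t * _·P_ 𝔽 (φs t) (ψs t) e)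
        ≈⟨ *-distribˡ-sum a (λ t → w t * _·P_ 𝔽 (φs t) (ψs t) e) ⟩
      ∑[ t < N ] (a * (w t * _·P_ 𝔽 (φs t) (ψs t) e))
        ≈⟨ sum-cong-≋ (λ t → x∙yz≈y∙xz a (w t) _) ⟩
      ∑[ t < N ] (w t * (a * _·P_ 𝔽 (φs t) (ψs t) e)) ∎

  NontrivialKernel : ∀ {N r} → (Fin N → Fin r → Carrier) → Set (c ⊔ ℓ)
  NontrivialKernel {N} {r} Q =
    Σ[ v ∈ (Fin r → Carrier) ] (∃[ k ] ¬ v k ≈ 0#) × (∀ t → ∑[ k < r ] (Q t k * v k) ≈ 0#)

  zeroColumn⇒nontrivialKernel : ∀ {N r} (Q : Fin N → Fin (suc r) → Carrier) →
                                (∀ t → Q t zero ≈ 0#) → NontrivialKernel Q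
  zeroColumn⇒nontrivialKernel {r = r} Q Q₀≈0 =
    e₀ , (zero , λ 1≈0 → 0≉1 (≈-sym 1≈0)) , λ t → begin
      Q t zero * 1# + ∑[ k < r ] (Q t (suc k) * 0#)
        ≈⟨ +-cong (≈-trans (*-identityʳ _) (Q₀≈0 t)) (sum-cong-≋ {r} (λ k → zeroʳ _)) ⟩
      0# + ∑[ k < r ] 0#
        ≈⟨ +-identityˡ _ ⟩
      ∑[ k < r ] 0#
        ≈⟨ sum-replicate-zero r ⟩
      0# ∎
    where
    e₀ : Fin (suc r) → Carrier
    e₀ zero    = 1#
    e₀ (suc _) = 0#

  sum-row-combination : ∀ {r} (x z μ : Fin r → Carrier) a →
                        ∑[ j < r ] ((x j + a * z j) * μ j) ≈ ∑[ j < r ] (x j * μ j) + a * ∑[ j < r ] (z j * μ j)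
  sum-row-combination {r} x z μ a = begin
    ∑[ j < r ] ((x j + a * z j) * μ j)
      ≈⟨ sum-cong-≋ (λ j → distribʳ (μ j) (x j) (a * z j)) ⟩
    ∑[ j < r ] (x j * μ j + (a * z j) * μ j)
      ≈⟨ ∑-distrib-+ (λ j → x j * μ j) (λ j → (a * z j) * μ j) ⟩
    ∑[ j < r ] (x j * μ j) + ∑[ j < r ] ((a * z j) * μ j)
      ≈⟨ +-congˡ (sum-cong-≋ (λ j → *-assoc a (z j) (μ j))) ⟩
    ∑[ j < r ] (x j * μ j) + ∑[ j < r ] (a * (z j * μ j))
      ≈⟨ +-congˡ (*-distribˡ-sum a (λ j → z j * μ j)) ⟨
    ∑[ j < r ] (x j * μ j) + a * ∑[ j < r ] (z j * μ j) ∎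

  clearFirstColumn : ∀ {N r} (Q : Fin N → Fin (suc r) → Carrier) → Fin N → Carrier →
                     Fin N → Fin r → Carrier
  clearFirstColumn Q t₀ a⁻¹ t j = Q t (suc j) + - (Q t zero * a⁻¹) * Q t₀ (suc j)

  nontrivialKernel-clearFirstColumn : ∀ {N r} (Q : Fin (suc N) → Fin (suc r) → Carrier) t₀ a⁻¹ →
                                      Q t₀ zero * a⁻¹ ≈ 1# →
                                      NontrivialKernel (clearFirstColumn Q t₀ a⁻¹ ∘ punchIn t₀) →
                                      NontrivialKernel Q
  nontrivialKernel-clearFirstColumn {N} {r} Q t₀ a⁻¹ pivot (μ , (k , μk≉0) , Q′μ≈0) =
    v , (suc k , μk≉0) , Qv≈0
    where
    coeff : Fin (suc N) → Carrier
    coeff t = - (Q t zero * a⁻¹)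

    S : Carrier
    S = ∑[ j < r ] (Q t₀ (suc j) * μ j)

    -- v₀ is chosen so that row t of Q v is row t of the cleared system applied to μ.
    v : Fin (suc r) → Carrier
    v zero    = - (a⁻¹ * S)
    v (suc j) = μ j

    clearedRow·μ : Fin (suc N) → Carrier
    clearedRow·μ t = ∑[ j < r ] (clearFirstColumn Q t₀ a⁻¹ t j * μ j)

    Qv≈clearedRow·μ : ∀ t → ∑[ k < suc r ] (Q t k * v k) ≈ clearedRow·μ t
    Qv≈clearedRow·μ t = begin
      Q t zero * - (a⁻¹ * S) + ∑[ j < r ] (Q t (suc j) * μ j)
        ≈⟨ +-comm _ _ ⟩
      ∑[ j < r ] (Q t (suc j) * μ j) + Q t zero * - (a⁻¹ * S)
        ≈⟨ +-congˡ (-‿distribʳ-* (Q t zero) (a⁻¹ * S)) ⟨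
      ∑[ j < r ] (Q t (suc j) * μ j) + - (Q t zero * (a⁻¹ * S))
        ≈⟨ +-congˡ (-‿cong (*-assoc _ _ _)) ⟨
      ∑[ j < r ] (Q t (suc j) * μ j) + - ((Q t zero * a⁻¹) * S)
        ≈⟨ +-congˡ (-‿distribˡ-* (Q t zero * a⁻¹) S) ⟩
      ∑[ j < r ] (Q t (suc j) * μ j) + coeff t * S
        ≈⟨ sum-row-combination (λ j → Q t (suc j)) (λ j → Q t₀ (suc j)) μ (coeff t) ⟨
      clearedRow·μ t ∎

    clearedRow·μ-pivot≈0 : clearedRow·μ t₀ ≈ 0#
    clearedRow·μ-pivot≈0 = begin
      clearedRow·μ t₀
        ≈⟨ sum-row-combination (λ j → Q t₀ (suc j)) (λ j → Q t₀ (suc j)) μ (coeff t₀) ⟩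
      S + coeff t₀ * S
        ≈⟨ +-congˡ (*-congʳ (-‿cong pivot)) ⟩
      S + - 1# * S
        ≈⟨ +-congˡ (-1*x≈-x S) ⟩
      S + - S
        ≈⟨ -‿inverseʳ S ⟩
      0# ∎

    Qv≈0 : ∀ t → ∑[ k < suc r ] (Q t k * v k) ≈ 0#
    Qv≈0 t with t Fin.≟ t₀
    ... | yes refl = ≈-trans (Qv≈clearedRow·μ t₀) clearedRow·μ-pivot≈0
    ... | no  t≢t₀ = ≈-trans (Qv≈clearedRow·μ t)
                       (subst (λ t′ → clearedRow·μ t′ ≈ 0#) (Fin.punchIn-punchOut t₀≢t) (Q′μ≈0 (punchOut t₀≢t)))
      where t₀≢t = t≢t₀ ∘ ≡.sym

  underdetermined⇒nontrivialKernel : ∀ {N r} → N < r → (Q : Fin N → Fin r → Carrier) →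
                                     ¬ ¬ NontrivialKernel Q
  underdetermined⇒nontrivialKernel {zero}  {suc r} _          Q ¬ker =
    ¬ker (zeroColumn⇒nontrivialKernel Q λ ())
  underdetermined⇒nontrivialKernel {suc N} {suc r} (s≤s N<r) Q ¬ker =
    ¬¬-all-or-counterexample (λ t → Q t zero ≈ 0#) λ where
      (inj₁ zeroColumn)   → ¬ker (zeroColumn⇒nontrivialKernel Q zeroColumn)
      (inj₂ (t₀ , Qt₀≉0)) →
        let (a⁻¹ , pivot) = inverse (Q t₀ zero) Qt₀≉0 in
        underdetermined⇒nontrivialKernel N<r (clearFirstColumn Q t₀ a⁻¹ ∘ punchIn t₀)
          (¬ker ∘ nontrivialKernel-clearFirstColumn Q t₀ a⁻¹ pivot)

  rank≤innerDimension : ∀ {m N} (M : Matrix 𝔽 m) (P : Fin m → Fin N → Carrier) (Q : Fin N → Fin m → Carrier) →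
                        (∀ i j → M i j ≈ ∑[ t < N ] (P i t * Q t j)) → RankAtMost 𝔽 M N
  rank≤innerDimension {N = N} M P Q M≈PQ r col independent =
    decidable-stable (r ≤? N) λ r≰N →
      underdetermined⇒nontrivialKernel (ℕ.≰⇒> r≰N) (λ t k → Q t (col k))
        λ (v , (k , vk≉0) , Qv≈0) → vk≉0 (independent v (columnCombination≈0 v Qv≈0) k)
    where
    columnCombination≈0 : ∀ v → (∀ t → ∑[ k < r ] (Q t (col k) * v k) ≈ 0#) →
                          ∀ i → sumFin 𝔽 (λ k → v k * M i (col k)) ≈ 0#
    columnCombination≈0 v Qv≈0 i = begin
      sumFin 𝔽 (λ k → v k * M i (col k))
        ≡⟨ sumFin≡sum (λ k → v k * M i (col k)) ⟩
      ∑[ k < r ] (v k * M i (col k))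
        ≈⟨ sum-cong-≋ (λ k → *-congˡ (M≈PQ i (col k))) ⟩
      ∑[ k < r ] (v k * ∑[ t < N ] (P i t * Q t (col k)))
        ≈⟨ sum-cong-≋ (λ k → *-distribˡ-sum (v k) (λ t → P i t * Q t (col k))) ⟩
      ∑[ k < r ] ∑[ t < N ] (v k * (P i t * Q t (col k)))
        ≈⟨ sum-cong-≋ (λ k → sum-cong-≋ (λ t → x∙yz≈y∙zx (v k) (P i t) (Q t (col k)))) ⟩
      ∑[ k < r ] ∑[ t < N ] (P i t * (Q t (col k) * v k))
        ≈⟨ ∑-comm (λ k t → P i t * (Q t (col k) * v k)) ⟩
      ∑[ t < N ] ∑[ k < r ] (P i t * (Q t (col k) * v k))
        ≈⟨ sum-cong-≋ (λ t → *-distribˡ-sum (P i t) (λ k → Q t (col k) * v k)) ⟨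
      ∑[ t < N ] (P i t * ∑[ k < r ] (Q t (col k) * v k))
        ≈⟨ sum-cong-≋ (λ t → ≈-trans (*-congˡ (Qv≈0 t)) (zeroʳ (P i t))) ⟩
      ∑[ t < N ] 0#
        ≈⟨ sum-replicate-zero N ⟩
      0# ∎

  module _ {n m} (f g : Fin m → Poly 𝔽 n) where

    coeffSpaceRank≤monomialsˡ : ∀ {d} → (∀ i → IsHomogeneous 𝔽 d (f i)) →
                                CoeffSpaceRankAtMost 𝔽 (_⊗_ 𝔽 f g) (length (monomials n d))
    coeffSpaceRank≤monomialsˡ {d} f-hom cs =
      rank≤innerDimension _ (λ i t → f i (A t)) (λ t j → coeffPairing cs (δ (A t)) (g j)) λ i j →
        coeffPairing-expand {w = f i ∘ A} {φs = δ ∘ A} {ψs = λ _ → g j} (expand i j) cs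
      where
      A : Fin (length (monomials n d)) → Exponent n
      A = lookup (monomials n d)

      expand : ∀ i j p q → f i p * g j q ≈ ∑[ t < length (monomials n d) ] (f i (A t) * (δ (A t) p * g j q))
      expand i j p q = begin
        f i p * g j q
          ≈⟨ *-congʳ (homogeneous-expansion (f-hom i) p) ⟩
        ∑[ t < length (monomials n d) ] (f i (A t) * δ (A t) p) * g j q
          ≈⟨ *-distribʳ-sum (g j q) (λ t → f i (A t) * δ (A t) p) ⟩
        ∑[ t < length (monomials n d) ] ((f i (A t) * δ (A t) p) * g j q)
          ≈⟨ sum-cong-≋ (λ t → *-assoc (f i (A t)) (δ (A t) p) (g j q)) ⟩
        ∑[ t < length (monomials n d) ] (f i (A t) * (δ (A t) p * g j q)) ∎

    coeffSpaceRank≤monomialsʳ : ∀ {d} → (∀ j → IsHomogeneous 𝔽 d (g j)) →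
                                CoeffSpaceRankAtMost 𝔽 (_⊗_ 𝔽 f g) (length (monomials n d))
    coeffSpaceRank≤monomialsʳ {d} g-hom cs =
      rank≤innerDimension _ (λ i t → coeffPairing cs (f i) (δ (B t))) (λ t j → g j (B t)) λ i j →
        ≈-trans (coeffPairing-expand {w = g j ∘ B} {φs = λ _ → f i} {ψs = δ ∘ B} (expand i j) cs)
                (sum-cong-≋ (λ t → *-comm (g j (B t)) _))
      where
      B : Fin (length (monomials n d)) → Exponent n
      B = lookup (monomials n d)

      expand : ∀ i j p q → f i p * g j q ≈ ∑[ t < length (monomials n d) ] (g j (B t) * (f i p * δ (B t) q))
      expand i j p q = begin
        f i p * g j q
          ≈⟨ *-congˡ (homogeneous-expansion (g-hom j) q) ⟩
        f i p * ∑[ t < length (monomials n d) ] (g j (B t) * δ (B t) q)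
          ≈⟨ *-distribˡ-sum (f i p) (λ t → g j (B t) * δ (B t) q) ⟩
        ∑[ t < length (monomials n d) ] (f i p * (g j (B t) * δ (B t) q))
          ≈⟨ sum-cong-≋ (λ t → x∙yz≈y∙xz (f i p) (g j (B t)) (δ (B t) q)) ⟩
        ∑[ t < length (monomials n d) ] (g j (B t) * (f i p * δ (B t) q)) ∎

open import Data.Nat using (_+_; _∸_; _⊓_)

mainTheorem6 : ∀ {c ℓ} (𝔽 : Field c ℓ) (n m d-f d-g : ℕ)
                 (f g : Fin m → Poly 𝔽 n) →
                 (∀ i → IsHomogeneous 𝔽 d-f (f i)) →
                 (∀ i → IsHomogeneous 𝔽 d-g (g i)) →
                 CoeffSpaceRankAtMost 𝔽 (_⊗_ 𝔽 f g)
                   (((n + d-f ∸ 1) C (n ∸ 1)) ⊓ ((n + d-g ∸ 1) C (n ∸ 1)))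
mainTheorem6 𝔽 n m d-f d-g f g f-hom g-hom cs r col independent =
  ℕ.⊓-glb (ℕ.≤-trans (coeffSpaceRank≤monomialsˡ 𝔽 f g f-hom cs r col independent) (length-monomials-≤ n d-f))
          (ℕ.≤-trans (coeffSpaceRank≤monomialsʳ 𝔽 f g g-hom cs r col independent) (length-monomials-≤ n d-g))
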